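{- Let $G$ be a star-clique path constructed from $G_1',\dots,G_k'$ as in the definition below. Then \[\operatorname{Z}(G)=\sum_{i=1}^k\operatorname{Z}(G_i')-k+1.\]
   Context: All graphs are finite, simple and undirected. Zero forcing: given $B\subseteq V(G)$ initially filled, a filled vertex $u$ may force an unfilled vertex $w$ if $w$ is the only unfilled neighbor of $u$; $B$ is a zero forcing set if repeated forcing fills all vertices; $\operatorname{Z}(G)$ is the minimum size of a zero forcing set. A star-clique path is a graph $G=G_k$ where $G_j=\bigcup_{i=1}^j G_i'$ for $j=1,\dots,k$, each $G_i'$ is a star $K_{1,s}$ or a complete graph, and: (1) for $i\in\{2,\dots,k\}$, $V(G_{i-1}')\cap V(G_i')=\{v_i\}$ for some vertex $v_i$, and $V(G_j')\cap V(G_i')=\emptyset$ for $j=1,\dots,i-2$; (2) $v_i\notin\{v_2,\dots,v_{i-1}\}$ for $i\in\{3,\dots,k\}$; (3) if $G_i'$ is a star for some $i\in\{2,\dots,k-1\}$, then $\deg_{G_i'}(v_i)=1$ and $\deg_{G_i'}(v_{i+1})=1$; (4) if $G_1'$ is a star then $\deg_{G_1'}(v_2)=1$, and if $G_k'$ is a star then $\deg_{G_k'}(v_k)=1$. -}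

module Defs where

open import Data.Nat using (ℕ; zero; suc; _+_; _∸_; _≤_)
open import Data.Fin using (Fin; zero; suc; toℕ; inject₁; _≟_)
open import Data.Fin.Subset using (Subset; _∈_; _∉_; _⊆_; ∣_∣; _∪_; ⁅_⁆)
open import Data.Bool using (Bool; _∧_; _∨_; not)
open import Data.Vec using (tabulate)
open import Data.Product using (Σ; ∃; _×_; _,_)
open import Data.Sum using (_⊎_)
open import Data.Empty using (⊥)
open import Relation.Nullary using (¬_; ⌊_⌋)
open import Relation.Binary.PropositionalEquality using (_≡_; _≢_)

-- A finite simple graph whose vertex set is a subset of Fin n.
-- (Vertices outside V are simply not part of the graph.)

record Graph (n : ℕ) : Set₁ where
  field
    V   : Fin n → Set
    Adj : Fin n → Fin n → Set

open Graph public

Forces : ∀ {n} → Graph n → Subset n → Fin n → Fin n → Set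
Forces G F u w =
  V G u × u ∈ F × V G w × w ∉ F × Adj G u w ×
  (∀ x → V G x → Adj G u x → x ≢ w → x ∈ F)

data FillsAll {n} (G : Graph n) : Subset n → Set where
  done  : ∀ {F} → (∀ x → V G x → x ∈ F) → FillsAll G F
  force : ∀ {F} u w → Forces G F u w → FillsAll G (F ∪ ⁅ w ⁆) → FillsAll G F

IsZeroForcingSet : ∀ {n} → Graph n → Subset n → Set
IsZeroForcingSet G B = (∀ x → x ∈ B → V G x) × FillsAll G B

IsZ : ∀ {n} → Graph n → ℕ → Set
IsZ G z =
  (Σ (Subset _) λ B → IsZeroForcingSet G B × ∣ B ∣ ≡ z) ×
  (∀ B → IsZeroForcingSet G B → z ≤ ∣ B ∣)

data Kind (n : ℕ) : Set where
  clique : Kind n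
  star   : (c : Fin n) → Kind n

record Piece (n : ℕ) : Set where
  constructor piece
  field
    S        : Subset n
    kind     : Kind n
    nonempty : ∃ λ x → x ∈ S
    centreIn : ∀ c → kind ≡ star c → c ∈ S

open Piece public

PieceAdj : ∀ {n} → Piece n → Fin n → Fin n → Set
PieceAdj P x y with kind P
... | clique = x ∈ S P × y ∈ S P × x ≢ y
... | star c = x ∈ S P × y ∈ S P × x ≢ y × (x ≡ c ⊎ y ≡ c)

pieceGraph : ∀ {n} → Piece n → Graph n
pieceGraph P = record { V = λ x → x ∈ S P ; Adj = PieceAdj P }

IsStar : ∀ {n} → Piece n → Set
IsStar P = ∃ λ c → kind P ≡ star c

pieceDeg : ∀ {n} → Piece n → Fin n → ℕ
pieceDeg {n} P x with kind P
... | clique = ∣ tabulate (λ y → Data.Vec.lookup (S P) y ∧ not ⌊ x ≟ y ⌋) ∣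
  where import Data.Vec
... | star c = ∣ tabulate (λ y → Data.Vec.lookup (S P) y ∧ not ⌊ x ≟ y ⌋
                                 ∧ (⌊ x ≟ c ⌋ ∨ ⌊ y ≟ c ⌋)) ∣
  where import Data.Vec

-- Star-clique path built from pieces G_1',...,G_k' (k = suc m), indexed by
-- Fin (suc m) (index i ↦ G_{i+1}'), with junction vertices
-- v : Fin m → Fin n  (junction j ↦ v_{j+2}, shared by G_{j+1}' and G_{j+2}').

record IsStarCliquePath {n m : ℕ} (P : Fin (suc m) → Piece n)
                        (v : Fin m → Fin n) : Set where
  field
    meet      : ∀ j x → (x ∈ S (P (inject₁ j)) × x ∈ S (P (suc j))) → x ≡ v j
    meetIn₁   : ∀ j → v j ∈ S (P (inject₁ j))
    meetIn₂   : ∀ j → v j ∈ S (P (suc j))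
    disjoint  : ∀ (i j : Fin (suc m)) → toℕ j + 2 ≤ toℕ i →
                ∀ x → x ∈ S (P j) → x ∈ S (P i) → ⊥
    distinct  : ∀ j j' → v j ≡ v j' → j ≡ j'
    starLeft  : ∀ j → IsStar (P (inject₁ j)) → pieceDeg (P (inject₁ j)) (v j) ≡ 1
    starRight : ∀ j → IsStar (P (suc j)) → pieceDeg (P (suc j)) (v j) ≡ 1

unionGraph : ∀ {n m} → (Fin (suc m) → Piece n) → Graph n
unionGraph P = record
  { V   = λ x → ∃ λ i → x ∈ S (P i)
  ; Adj = λ x y → ∃ λ i → PieceAdj (P i) x y }

∑ : ∀ {k} → (Fin k → ℕ) → ℕ
∑ {zero}  f = 0
∑ {suc k} f = f zero + ∑ (λ i → f (suc i))

-- Give each piece the potential φ: one unit if some edge of it has an unfilled end, and one more if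
-- it is a star with at least two leaves and unfilled centre.  A force u → w happens along an edge of
-- some piece and strictly lowers that piece's potential, while no potential ever rises; hence every
-- zero forcing set B of a union of pieces has |V| ≤ |B| + Σᵢ φᵢ(∅).  In a star-clique path the bound
-- is attained: filling the pieces from left to right, piece i needs at most φᵢ(∅) forces, performed
-- by forcers that avoid the junction with the next piece onto targets that avoid the junction with
-- the previous one (conditions (3) and (4) keep the centre of a star with two leaves off the
-- junctions).  So Z(G) = |V| − Σᵢ φᵢ(∅), in particular Z(Gᵢ') = |V(Gᵢ')| − φᵢ(∅), and consecutive
-- pieces share exactly one vertex, so |V| = Σᵢ |V(Gᵢ')| − (k − 1).

module Submission where

open import Defs
open import Data.Nat using (ℕ; zero; suc; _+_; _∸_; _≤_; _<_; z≤n; s≤s)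
open import Data.Nat.Properties hiding (_≟_)
open import Data.Fin using (Fin; zero; suc; toℕ; inject₁; fromℕ<; _≟_)
open import Data.Fin.Properties
  using (any?; toℕ-injective; toℕ-inject₁; toℕ-fromℕ<; toℕ<n; inject₁-injective)
  renaming (suc-injective to fsuc-injective; <-cmp to <-cmpᶠ)
open import Data.Fin.Subset
  using (Subset; _∈_; _∉_; _⊆_; ∣_∣; _∪_; ⁅_⁆; inside; outside) renaming (⊥ to ∅)
open import Data.Fin.Subset.Properties
  using ( _∈?_; p⊆p∪q; q⊆p∪q; x∈p∪q⁻; x∈⁅x⁆; x∈⁅y⁆⇒x≡y; x≢y⇒x∉⁅y⁆; ∣⁅x⁆∣≡1; p⊆q⇒∣p∣≤∣q∣
        ; drop-there; ∉⊥; ∪-identityʳ)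
open import Data.Vec using ([]; _∷_; here; there; tabulate; lookup)
open import Data.Vec.Properties using (lookup∘tabulate; []=⇒lookup; lookup⇒[]=)
open import Data.Bool using (Bool; true; _∧_; _∨_; not)
open import Data.Product using (Σ; ∃; _×_; _,_; proj₁; proj₂)
open import Data.Sum using (_⊎_; inj₁; inj₂; [_,_]′)
open import Data.Empty renaming (⊥ to Empty)
open import Data.Unit using (⊤; tt)
open import Relation.Nullary
open import Relation.Nullary.Decidable using (_×-dec_; _⊎-dec_; map′; isYes; ⌊_⌋)
open import Function using (id; _∘_; _⇔_; mk⇔; Equivalence)
open import Relation.Binary.PropositionalEquality
open import Relation.Binary.Definitions using (tri<; tri≈; tri>)
open import Algebra.Properties.CommutativeSemigroup +-commutativeSemigroup using (interchange; xy∙z≈xz∙y)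

-- Indicators, finite sums and subsets

χ : ∀ {A : Set} → Dec A → ℕ
χ (yes _) = 1
χ (no _)  = 0

χ-yes : ∀ {A : Set} (d : Dec A) → A → χ d ≡ 1
χ-yes (yes _) _ = refl
χ-yes (no ¬a) a = ⊥-elim (¬a a)

χ-no : ∀ {A : Set} (d : Dec A) → ¬ A → χ d ≡ 0
χ-no (yes a) ¬a = ⊥-elim (¬a a)
χ-no (no _)  _  = refl

χ-mono : ∀ {A B : Set} → (A → B) → (d : Dec A) (e : Dec B) → χ d ≤ χ e
χ-mono f (yes a) (yes b) = ≤-refl
χ-mono f (yes a) (no ¬b) = ⊥-elim (¬b (f a))
χ-mono f (no _)  e       = z≤n

χ-cong : ∀ {A B : Set} → (A → B) → (B → A) → (d : Dec A) (e : Dec B) → χ d ≡ χ e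
χ-cong f g d e = ≤-antisym (χ-mono f d e) (χ-mono g e d)

χ-⊎ : ∀ {A B C : Set} (a : Dec A) (b : Dec B) (c : Dec C) →
      (A → B ⊎ C) → (B ⊎ C → A) → (B → C → Empty) → χ a ≡ χ b + χ c
χ-⊎ a (yes b) (yes c) _  _    disjoint = ⊥-elim (disjoint b c)
χ-⊎ a (yes b) (no _)  _  from _        = χ-yes a (from (inj₁ b))
χ-⊎ a (no _)  (yes c) _  from _        = χ-yes a (from (inj₂ c))
χ-⊎ a (no ¬b) (no ¬c) to _    _        = χ-no a (λ x → [ ¬b , ¬c ]′ (to x))

χ≤1 : ∀ {A : Set} (d : Dec A) → χ d ≤ 1
χ≤1 (yes _) = ≤-refl
χ≤1 (no _)  = z≤n

∑-cong : ∀ {k} {f g : Fin k → ℕ} → (∀ i → f i ≡ g i) → ∑ f ≡ ∑ g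
∑-cong {zero}  h = refl
∑-cong {suc k} h = cong₂ _+_ (h zero) (∑-cong (λ i → h (suc i)))

∑-distrib-+ : ∀ {k} (f g : Fin k → ℕ) → ∑ (λ i → f i + g i) ≡ ∑ f + ∑ g
∑-distrib-+ {zero}  f g = refl
∑-distrib-+ {suc k} f g = trans (cong (f zero + g zero +_) (∑-distrib-+ (λ i → f (suc i)) (λ i → g (suc i))))
                                (interchange (f zero) (g zero) _ _)

∑-mono-≤ : ∀ {k} {f g : Fin k → ℕ} → (∀ i → f i ≤ g i) → ∑ f ≤ ∑ g
∑-mono-≤ {zero}  h = z≤n
∑-mono-≤ {suc k} h = +-mono-≤ (h zero) (∑-mono-≤ (λ i → h (suc i)))

∑-mono-< : ∀ {k} {f g : Fin k → ℕ} (j : Fin k) → f j < g j → (∀ i → f i ≤ g i) → ∑ f < ∑ g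
∑-mono-< zero    lt h = +-mono-≤ lt (∑-mono-≤ (λ i → h (suc i)))
∑-mono-< {f = f} {g} (suc j) lt h =
  subst (_≤ ∑ g) (+-suc (f zero) _) (+-mono-≤ (h zero) (∑-mono-< j lt (λ i → h (suc i))))

∑-zero : ∀ k → ∑ {k} (λ _ → 0) ≡ 0
∑-zero zero    = refl
∑-zero (suc k) = ∑-zero k

∑-comm : ∀ {k l} (f : Fin k → Fin l → ℕ) →
         ∑ (λ i → ∑ (λ j → f i j)) ≡ ∑ (λ j → ∑ (λ i → f i j))
∑-comm {zero}  {l} f = sym (∑-zero l)
∑-comm {suc k} f = trans (cong (∑ (f zero) +_) (∑-comm (λ i → f (suc i))))
                         (sym (∑-distrib-+ (f zero) (λ j → ∑ (λ i → f (suc i) j))))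

∑-one : ∀ k → ∑ {k} (λ _ → 1) ≡ k
∑-one zero    = refl
∑-one (suc k) = cong suc (∑-one k)

count : ∀ {k} {Q : Fin k → Set} → (∀ i → Dec (Q i)) → ℕ
count d = ∑ (λ i → χ (d i))

count-unique : ∀ {k} {Q : Fin k → Set} (d : ∀ i → Dec (Q i)) →
               (∀ i j → Q i → Q j → i ≡ j) → (e : Dec (∃ Q)) → count d ≡ χ e
count-unique {zero}  d u e = sym (χ-no e (λ { (() , _) }))
count-unique {suc k} {Q} d u e with d zero
... | yes q₀ = begin
    1 + count (λ i → d (suc i))  ≡⟨ cong (1 +_) (count-unique _ (λ i j qi qj → fsuc-injective (u _ _ qi qj))
                                                   (no (λ { (i , qi) → 0≢suc (u _ _ q₀ qi) }))) ⟩
    1                            ≡⟨ sym (χ-yes e (zero , q₀)) ⟩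
    χ e                          ∎
  where
  open ≡-Reasoning
  0≢suc : ∀ {i : Fin k} → Fin.zero ≢ suc i
  0≢suc ()
... | no ¬q₀ = trans (count-unique _ (λ i j qi qj → fsuc-injective (u _ _ qi qj)) (any? (λ i → d (suc i))))
                     (χ-cong (λ { (i , q) → suc i , q })
                             (λ { (zero , q) → ⊥-elim (¬q₀ q) ; (suc i , q) → i , q })
                             (any? (λ i → d (suc i))) e)

count-≡ : ∀ {k} (a : Fin k) → count (_≟ a) ≡ 1
count-≡ a = count-unique (_≟ a) (λ i j p q → trans p (sym q)) (yes (a , refl))

∣p∣≡count : ∀ {n} (p : Subset n) → ∣ p ∣ ≡ count (_∈? p)
∣p∣≡count []            = refl
∣p∣≡count (inside ∷ p)  = cong suc (trans (∣p∣≡count p) (∑-cong (λ x → χ-cong there drop-there (x ∈? p) _)))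
∣p∣≡count (outside ∷ p) = trans (∣p∣≡count p) (∑-cong (λ x → χ-cong there drop-there (x ∈? p) _))

∣p∪⁅x⁆∣≡1+∣p∣ : ∀ {n} (p : Subset n) (x : Fin n) → x ∉ p → ∣ p ∪ ⁅ x ⁆ ∣ ≡ suc ∣ p ∣
∣p∪⁅x⁆∣≡1+∣p∣ (inside ∷ p)  zero    x∉p = ⊥-elim (x∉p here)
∣p∪⁅x⁆∣≡1+∣p∣ (outside ∷ p) zero    x∉p = cong (λ q → suc ∣ q ∣) (∪-identityʳ p)
∣p∪⁅x⁆∣≡1+∣p∣ (inside ∷ p)  (suc x) x∉p = cong suc (∣p∪⁅x⁆∣≡1+∣p∣ p x (λ x∈p → x∉p (there x∈p)))
∣p∪⁅x⁆∣≡1+∣p∣ (outside ∷ p) (suc x) x∉p = ∣p∪⁅x⁆∣≡1+∣p∣ p x (λ x∈p → x∉p (there x∈p))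

∈-tabulate⁺ : ∀ {n} (f : Fin n → Bool) {x} → f x ≡ true → x ∈ tabulate f
∈-tabulate⁺ f {x} fx = lookup⇒[]= x (tabulate f) (trans (lookup∘tabulate f x) fx)

∈-tabulate⁻ : ∀ {n} (f : Fin n → Bool) {x} → x ∈ tabulate f → f x ≡ true
∈-tabulate⁻ f {x} x∈ = trans (sym (lookup∘tabulate f x)) ([]=⇒lookup x∈)

toSubset : ∀ {n} {Q : Fin n → Set} → (∀ x → Dec (Q x)) → Subset n
toSubset Q? = tabulate (λ x → isYes (Q? x))

∈-toSubset⁺ : ∀ {n} {Q : Fin n → Set} (Q? : ∀ x → Dec (Q x)) {x} → Q x → x ∈ toSubset Q?
∈-toSubset⁺ Q? {x} q = ∈-tabulate⁺ _ (isYes≗true (Q? x) q)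
  where
  isYes≗true : ∀ {A : Set} (d : Dec A) → A → isYes d ≡ true
  isYes≗true (yes _) _ = refl
  isYes≗true (no ¬a) a = ⊥-elim (¬a a)

∈-toSubset⁻ : ∀ {n} {Q : Fin n → Set} (Q? : ∀ x → Dec (Q x)) {x} → x ∈ toSubset Q? → Q x
∈-toSubset⁻ Q? {x} x∈ = witness (Q? x) (∈-tabulate⁻ _ x∈)
  where
  witness : ∀ {A : Set} (d : Dec A) → isYes d ≡ true → A
  witness (yes a) _ = a

x∈p∪⁅x⁆ : ∀ {n} (p : Subset n) (x : Fin n) → x ∈ p ∪ ⁅ x ⁆
x∈p∪⁅x⁆ p x = q⊆p∪q p ⁅ x ⁆ (x∈⁅x⁆ x)

-- Zero forcing

record _≅_ {n} (G H : Graph n) : Set where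
  field
    V⇒   : ∀ {x} → V G x → V H x
    V⇐   : ∀ {x} → V H x → V G x
    Adj⇒ : ∀ {x y} → Adj G x y → Adj H x y
    Adj⇐ : ∀ {x y} → Adj H x y → Adj G x y

≅-sym : ∀ {n} {G H : Graph n} → G ≅ H → H ≅ G
≅-sym e = record { V⇒ = V⇐ ; V⇐ = V⇒ ; Adj⇒ = Adj⇐ ; Adj⇐ = Adj⇒ }
  where open _≅_ e

module _ {n} {G H : Graph n} (e : G ≅ H) where
  open _≅_ e

  forces-≅ : ∀ {F u w} → Forces G F u w → Forces H F u w
  forces-≅ (vu , uF , vw , w∉F , uw , nb) =
    V⇒ vu , uF , V⇒ vw , w∉F , Adj⇒ uw , (λ x vx ux x≢w → nb x (V⇐ vx) (Adj⇐ ux) x≢w)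

  fillsAll-≅ : ∀ {F} → FillsAll G F → FillsAll H F
  fillsAll-≅ (done all)          = done (λ x vx → all x (V⇐ vx))
  fillsAll-≅ (force u w fw rest) = force u w (forces-≅ fw) (fillsAll-≅ rest)

  isZeroForcingSet-≅ : ∀ {B} → IsZeroForcingSet G B → IsZeroForcingSet H B
  isZeroForcingSet-≅ (B⊆V , fills) = (λ x x∈B → V⇒ (B⊆V x x∈B)) , fillsAll-≅ fills

isZ-≅ : ∀ {n} {G H : Graph n} {z} → G ≅ H → IsZ G z → IsZ H z
isZ-≅ e ((B , zfs , ∣B∣≡z) , minimal) =
  (B , isZeroForcingSet-≅ e zfs , ∣B∣≡z) ,
  (λ B′ zfs′ → minimal B′ (isZeroForcingSet-≅ (≅-sym e) zfs′))

isZ-unique : ∀ {n} {G : Graph n} {a b} → IsZ G a → IsZ G b → a ≡ b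
isZ-unique ((A , zfsA , refl) , minA) ((B , zfsB , refl) , minB) = ≤-antisym (minA B zfsB) (minB A zfsA)

fillsAll-potential : ∀ {n} (G : Graph n) (V? : ∀ x → Dec (V G x)) (Ψ : Subset n → ℕ) →
                     (∀ F u w → Forces G F u w → Ψ (F ∪ ⁅ w ⁆) < Ψ F) →
                     ∀ F → FillsAll G F → count V? ≤ ∣ F ∣ + Ψ F
fillsAll-potential G V? Ψ decreasing F (done all) = begin
  count V?      ≤⟨ ∑-mono-≤ (λ x → χ-mono (all x) (V? x) (x ∈? F)) ⟩
  count (_∈? F) ≡⟨ ∣p∣≡count F ⟨
  ∣ F ∣         ≤⟨ m≤m+n ∣ F ∣ (Ψ F) ⟩
  ∣ F ∣ + Ψ F   ∎
  where open ≤-Reasoning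
fillsAll-potential G V? Ψ decreasing F (force u w fw@(_ , _ , _ , w∉F , _) rest) = begin
  count V?                      ≤⟨ fillsAll-potential G V? Ψ decreasing (F ∪ ⁅ w ⁆) rest ⟩
  ∣ F ∪ ⁅ w ⁆ ∣ + Ψ (F ∪ ⁅ w ⁆) ≡⟨ cong (_+ Ψ (F ∪ ⁅ w ⁆)) (∣p∪⁅x⁆∣≡1+∣p∣ F w w∉F) ⟩
  suc ∣ F ∣ + Ψ (F ∪ ⁅ w ⁆)     ≡⟨ +-suc ∣ F ∣ _ ⟨
  ∣ F ∣ + suc (Ψ (F ∪ ⁅ w ⁆))   ≤⟨ +-monoʳ-≤ ∣ F ∣ (decreasing F u w fw) ⟩
  ∣ F ∣ + Ψ F                   ∎
  where open ≤-Reasoning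

-- Pieces and their potential

TwoLeaves : ∀ {n} → Subset n → Fin n → Set
TwoLeaves S c = ∃ λ l₁ → ∃ λ l₂ → l₁ ∈ S × l₂ ∈ S × l₁ ≢ c × l₂ ≢ c × l₁ ≢ l₂

twoLeaves? : ∀ {n} (S : Subset n) (c : Fin n) → Dec (TwoLeaves S c)
twoLeaves? S c = any? λ l₁ → any? λ l₂ →
  (l₁ ∈? S) ×-dec (l₂ ∈? S) ×-dec ¬? (l₁ ≟ c) ×-dec ¬? (l₂ ≟ c) ×-dec ¬? (l₁ ≟ l₂)

ProperStar : ∀ {n} → Piece n → Set
ProperStar P = ∃ λ c → kind P ≡ star c × TwoLeaves (S P) c

properStar? : ∀ {n} (P : Piece n) → Dec (ProperStar P)
properStar? P with kind P
... | clique = no λ { (c , () , _) }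
... | star c = map′ (λ tl → c , refl , tl) (λ { (c , refl , tl) → tl }) (twoLeaves? (S P) c)

adj? : ∀ {n} (P : Piece n) x y → Dec (PieceAdj P x y)
adj? P x y with kind P
... | clique = (x ∈? S P) ×-dec (y ∈? S P) ×-dec ¬? (x ≟ y)
... | star c = (x ∈? S P) ×-dec (y ∈? S P) ×-dec ¬? (x ≟ y) ×-dec ((x ≟ c) ⊎-dec (y ≟ c))

adj⇒∈S : ∀ {n} (P : Piece n) {x y} → PieceAdj P x y → x ∈ S P × y ∈ S P
adj⇒∈S P pa with kind P
... | clique = let (x∈S , y∈S , _) = pa in x∈S , y∈S
... | star c = let (x∈S , y∈S , _) = pa in x∈S , y∈S

adj⇒≢ : ∀ {n} (P : Piece n) {x y} → PieceAdj P x y → x ≢ y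
adj⇒≢ P pa with kind P
... | clique = let (_ , _ , x≢y) = pa in x≢y
... | star c = let (_ , _ , x≢y , _) = pa in x≢y

starAdj : ∀ {n} (P : Piece n) {c x y} → kind P ≡ star c →
          PieceAdj P x y ⇔ (x ∈ S P × y ∈ S P × x ≢ y × (x ≡ c ⊎ y ≡ c))
starAdj (piece S (star c) ne ci) refl = mk⇔ id id

¬properStar⇒adj : ∀ {n} (P : Piece n) → ¬ ProperStar P →
                  ∀ {a b} → a ∈ S P → b ∈ S P → a ≢ b → PieceAdj P a b
¬properStar⇒adj (piece S clique ne ci)   ¬ps a∈S b∈S a≢b = a∈S , b∈S , a≢b
¬properStar⇒adj (piece S (star c) ne ci) ¬ps {a} {b} a∈S b∈S a≢b with a ≟ c | b ≟ c
... | yes a≡c | _       = a∈S , b∈S , a≢b , inj₁ a≡c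
... | no _    | yes b≡c = a∈S , b∈S , a≢b , inj₂ b≡c
... | no a≢c  | no b≢c  = ⊥-elim (¬ps (c , refl , a , b , a∈S , b∈S , a≢c , b≢c , a≢b))

properStar-centre-deg : ∀ {n} (P : Piece n) {c} → kind P ≡ star c → TwoLeaves (S P) c →
                        2 ≤ pieceDeg P c
properStar-centre-deg (piece S (star c) _ _) refl (l₁ , l₂ , l₁∈S , l₂∈S , l₁≢c , l₂≢c , l₁≢l₂) =
  begin
    2                       ≡⟨ cong suc (∣⁅x⁆∣≡1 l₁) ⟨
    suc ∣ ⁅ l₁ ⁆ ∣          ≡⟨ ∣p∪⁅x⁆∣≡1+∣p∣ ⁅ l₁ ⁆ l₂ (x≢y⇒x∉⁅y⁆ (≢-sym l₁≢l₂)) ⟨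
    ∣ ⁅ l₁ ⁆ ∪ ⁅ l₂ ⁆ ∣     ≤⟨ p⊆q⇒∣p∣≤∣q∣ leaves⊆nbhd ⟩
    ∣ tabulate adjacent ∣   ∎
  where
  open ≤-Reasoning
  adjacent : Fin _ → Bool
  adjacent y = lookup S y ∧ not ⌊ c ≟ y ⌋ ∧ (⌊ c ≟ c ⌋ ∨ ⌊ y ≟ c ⌋)
  leaf-adjacent : ∀ {y} → y ∈ S → y ≢ c → adjacent y ≡ true
  leaf-adjacent {y} y∈S y≢c with c ≟ y | c ≟ c
  ... | yes c≡y | _       = ⊥-elim (y≢c (sym c≡y))
  ... | no _    | no c≢c  = ⊥-elim (c≢c refl)
  ... | no _    | yes _   rewrite []=⇒lookup y∈S = refl
  leaves⊆nbhd : ⁅ l₁ ⁆ ∪ ⁅ l₂ ⁆ ⊆ tabulate adjacent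
  leaves⊆nbhd y∈ with x∈p∪q⁻ ⁅ l₁ ⁆ ⁅ l₂ ⁆ y∈
  ... | inj₁ y∈⁅l₁⁆ rewrite x∈⁅y⁆⇒x≡y l₁ y∈⁅l₁⁆ = ∈-tabulate⁺ _ (leaf-adjacent l₁∈S l₁≢c)
  ... | inj₂ y∈⁅l₂⁆ rewrite x∈⁅y⁆⇒x≡y l₂ y∈⁅l₂⁆ = ∈-tabulate⁺ _ (leaf-adjacent l₂∈S l₂≢c)

HasOpenEdge : ∀ {n} → Piece n → Subset n → Set
HasOpenEdge P F = ∃ λ x → ∃ λ y → PieceAdj P x y × ¬ (x ∈ F × y ∈ F)

openEdge? : ∀ {n} (P : Piece n) F → Dec (HasOpenEdge P F)
openEdge? P F = any? λ x → any? λ y → adj? P x y ×-dec ¬? ((x ∈? F) ×-dec (y ∈? F))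

HasOpenCentre : ∀ {n} → Piece n → Subset n → Set
HasOpenCentre P F = ∃ λ c → kind P ≡ star c × c ∉ F × TwoLeaves (S P) c

openCentre? : ∀ {n} (P : Piece n) F → Dec (HasOpenCentre P F)
openCentre? P F with kind P
... | clique = no λ { (c , () , _) }
... | star c = map′ (λ { (c∉F , tl) → c , refl , c∉F , tl }) (λ { (c , refl , c∉F , tl) → c∉F , tl })
                    (¬? (c ∈? F) ×-dec twoLeaves? (S P) c)

φ : ∀ {n} → Piece n → Subset n → ℕ
φ P F = χ (openEdge? P F) + χ (openCentre? P F)

φ-antitone : ∀ {n} (P : Piece n) F F′ → F ⊆ F′ → φ P F′ ≤ φ P F
φ-antitone P F F′ F⊆F′ = +-mono-≤
  (χ-mono (λ { (x , y , xy , open′) → x , y , xy , λ { (x∈F , y∈F) → open′ (F⊆F′ x∈F , F⊆F′ y∈F) } })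
          (openEdge? P F′) (openEdge? P F))
  (χ-mono (λ { (c , k , c∉F′ , tl) → c , k , (λ c∈F → c∉F′ (F⊆F′ c∈F)) , tl })
          (openCentre? P F′) (openCentre? P F))

φ-filled : ∀ {n} (P : Piece n) F → (∀ x → x ∈ S P → x ∈ F) → φ P F ≡ 0
φ-filled P F filled = cong₂ _+_
  (χ-no (openEdge? P F) λ { (x , y , xy , open′) →
    let (x∈S , y∈S) = adj⇒∈S P xy in open′ (filled x x∈S , filled y y∈S) })
  (χ-no (openCentre? P F) λ { (c , k , c∉F , _) → c∉F (filled c (centreIn P c k)) })

star-injective : ∀ {n} {a b : Fin n} → Kind.star a ≡ star b → a ≡ b
star-injective refl = refl

S⊆F∪⁅w⁆ : ∀ {n} (S F : Subset n) u w → u ∈ F → (∀ x → x ∈ S → x ≢ u → x ≢ w → x ∈ F) →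
            ∀ x → x ∈ S → x ∈ F ∪ ⁅ w ⁆
S⊆F∪⁅w⁆ S F u w u∈F others x x∈S with x ≟ w | x ≟ u
... | yes refl | _        = x∈p∪⁅x⁆ F x
... | no _     | yes refl = p⊆p∪q _ u∈F
... | no x≢w   | no x≢u   = p⊆p∪q _ (others x x∈S x≢u x≢w)

forcing-fills-piece : ∀ {n} (P : Piece n) F u w → u ∈ F → PieceAdj P u w →
                      (∀ x → x ∈ S P → PieceAdj P u x → x ≢ w → x ∈ F) →
                      (∀ x → x ∈ S P → x ∈ F ∪ ⁅ w ⁆) ⊎ (kind P ≡ star w × TwoLeaves (S P) w)
forcing-fills-piece (piece S clique _ _) F u w u∈F (u∈S , _) nb =
  inj₁ (S⊆F∪⁅w⁆ S F u w u∈F λ x x∈S x≢u → nb x x∈S (u∈S , x∈S , ≢-sym x≢u))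
forcing-fills-piece (piece S (star c) _ _) F u w u∈F (u∈S , _ , _ , inj₁ refl) nb =
  inj₁ (S⊆F∪⁅w⁆ S F u w u∈F λ x x∈S x≢u → nb x x∈S (u∈S , x∈S , ≢-sym x≢u , inj₁ refl))
forcing-fills-piece (piece S (star c) _ _) F u w u∈F (u∈S , _ , u≢w , inj₂ refl) nb
  with twoLeaves? S w
... | yes tl = inj₂ (refl , tl)
... | no ¬tl = inj₁ (S⊆F∪⁅w⁆ S F u w u∈F λ x x∈S x≢u x≢w →
                 ⊥-elim (¬tl (u , x , u∈S , x∈S , u≢w , x≢w , ≢-sym x≢u)))

φ-force : ∀ {n} (P : Piece n) F u w → u ∈ F → w ∉ F → PieceAdj P u w →
          (∀ x → x ∈ S P → PieceAdj P u x → x ≢ w → x ∈ F) → φ P (F ∪ ⁅ w ⁆) < φ P F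
φ-force P F u w u∈F w∉F uw nb = decrease (forcing-fills-piece P F u w u∈F uw nb)
  where
  open ≤-Reasoning
  edge-open : χ (openEdge? P F) ≡ 1
  edge-open = χ-yes (openEdge? P F) (u , w , uw , λ { (_ , w∈F) → w∉F w∈F })
  decrease : (∀ x → x ∈ S P → x ∈ F ∪ ⁅ w ⁆) ⊎ (kind P ≡ star w × TwoLeaves (S P) w) →
             φ P (F ∪ ⁅ w ⁆) < φ P F
  decrease (inj₁ filled) = begin-strict
    φ P (F ∪ ⁅ w ⁆)    ≡⟨ φ-filled P (F ∪ ⁅ w ⁆) filled ⟩
    0                  <⟨ s≤s z≤n ⟩
    1                  ≡⟨ edge-open ⟨
    χ (openEdge? P F)  ≤⟨ m≤m+n _ _ ⟩
    φ P F              ∎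
  decrease (inj₂ (k , tl)) = begin-strict
    φ P (F ∪ ⁅ w ⁆)    ≤⟨ +-mono-≤ (χ≤1 (openEdge? P _)) (≤-reflexive centre-filled) ⟩
    1 + 0              <⟨ s≤s (s≤s z≤n) ⟩
    1 + 1              ≡⟨ cong₂ _+_ edge-open (χ-yes (openCentre? P F) (w , k , w∉F , tl)) ⟨
    φ P F              ∎
    where
    centre-filled : χ (openCentre? P (F ∪ ⁅ w ⁆)) ≡ 0
    centre-filled = χ-no (openCentre? P _) λ { (c , k′ , c∉F′ , _) →
      c∉F′ (subst (_∈ F ∪ ⁅ w ⁆) (star-injective (trans (sym k) k′)) (x∈p∪⁅x⁆ F w)) }

∈union? : ∀ {n m} (P : Fin (suc m) → Piece n) x → Dec (V (unionGraph P) x)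
∈union? P x = any? (λ i → x ∈? S (P i))

Φ : ∀ {n m} → (Fin (suc m) → Piece n) → Subset n → ℕ
Φ P F = ∑ (λ i → φ (P i) F)

zeroForcingSet-lower-bound : ∀ {n m} (P : Fin (suc m) → Piece n) B → IsZeroForcingSet (unionGraph P) B →
                             count (∈union? P) ≤ ∣ B ∣ + Φ P ∅
zeroForcingSet-lower-bound P B (_ , fills) = begin
  count (∈union? P)  ≤⟨ fillsAll-potential (unionGraph P) (∈union? P) (Φ P) Φ-force B fills ⟩
  ∣ B ∣ + Φ P B      ≤⟨ +-monoʳ-≤ ∣ B ∣ (∑-mono-≤ (λ i → φ-antitone (P i) ∅ B (⊥-elim ∘ ∉⊥))) ⟩
  ∣ B ∣ + Φ P ∅      ∎
  where
  open ≤-Reasoning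
  Φ-force : ∀ F u w → Forces (unionGraph P) F u w → Φ P (F ∪ ⁅ w ⁆) < Φ P F
  Φ-force F u w (_ , u∈F , _ , w∉F , (i , uw) , nb) =
    ∑-mono-< i (φ-force (P i) F u w u∈F w∉F uw (λ x x∈S ux x≢w → nb x (i , x∈S) (i , ux) x≢w))
             (λ j → φ-antitone (P j) F (F ∪ ⁅ w ⁆) (p⊆p∪q _))

-- Star-clique paths

inject₁≢suc : ∀ {m} (k : Fin m) → inject₁ k ≢ suc k
inject₁≢suc k e = <⇒≢ (n<1+n (toℕ k)) (trans (sym (toℕ-inject₁ k)) (cong toℕ e))

leftJunction? : ∀ {m} (i : Fin (suc m)) → (Σ (Fin m) λ k → i ≡ suc k) ⊎ (∀ k → i ≢ suc k)
leftJunction? zero    = inj₂ (λ k ())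
leftJunction? (suc k) = inj₁ (k , refl)

rightJunction? : ∀ {m} (i : Fin (suc m)) → (Σ (Fin m) λ k → i ≡ inject₁ k) ⊎ (∀ k → i ≢ inject₁ k)
rightJunction? {zero}  zero    = inj₂ (λ ())
rightJunction? {suc m} zero    = inj₁ (zero , refl)
rightJunction? {suc m} (suc i) with rightJunction? i
... | inj₁ (k , e) = inj₁ (suc k , cong suc e)
... | inj₂ none    = inj₂ λ { zero () ; (suc k) e → none k (fsuc-injective e) }

avoiding : ∀ {n} (Q : Fin n → Set) (b : Fin n) {x y} → x ≢ y → Q x → Q y → Σ (Fin n) λ z → Q z × z ≢ b
avoiding Q b {x} {y} x≢y qx qy with x ≟ b
... | yes refl = y , qy , ≢-sym x≢y
... | no x≢b   = x , qx , x≢b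

module StarCliquePath {n m : ℕ} (P : Fin (suc m) → Piece n) (v : Fin m → Fin n)
                      (scp : IsStarCliquePath P v) where
  open IsStarCliquePath scp

  G : Graph n
  G = unionGraph P

  shared-vertex : ∀ i j {x} → x ∈ S (P i) → x ∈ S (P j) → toℕ j < toℕ i →
                  Σ (Fin m) λ k → j ≡ inject₁ k × i ≡ suc k × x ≡ v k
  shared-vertex (suc i) j {x} x∈i x∈j j<i with m<1+n⇒m<n∨m≡n j<i
  ... | inj₁ j<i′ =
    ⊥-elim (disjoint (suc i) j (subst (_≤ suc (toℕ i)) (+-comm 2 (toℕ j)) (s≤s j<i′)) x x∈j x∈i)
  ... | inj₂ j≡i  = i , j≡inject₁i , refl , meet i x (subst (λ k → x ∈ S (P k)) j≡inject₁i x∈j , x∈i)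
    where
    j≡inject₁i : j ≡ inject₁ i
    j≡inject₁i = toℕ-injective (trans j≡i (sym (toℕ-inject₁ i)))

  AvoidsLeft AvoidsRight : Fin (suc m) → Fin n → Set
  AvoidsLeft  i x = ∀ k → i ≡ suc k → x ≢ v k
  AvoidsRight i x = ∀ k → i ≡ inject₁ k → x ≢ v k

  properStar-centre-avoids : ∀ i {c} → kind (P i) ≡ star c → TwoLeaves (S (P i)) c →
                             AvoidsLeft i c × AvoidsRight i c
  properStar-centre-avoids i {c} k tl =
    (λ { j refl refl → deg≢1 (starRight j (c , k)) }) , (λ { j refl refl → deg≢1 (starLeft j (c , k)) })
    where
    deg≢1 : pieceDeg (P i) c ≢ 1
    deg≢1 deg≡1 = 1+n≰n (subst (2 ≤_) deg≡1 (properStar-centre-deg (P i) k tl))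

  -- The forcer is the junction with the previous piece if there is one, so every other vertex avoids it.
  choose-forcer : ∀ i (Q : Fin n → Set) {x y} → x ≢ y → x ∈ S (P i) → y ∈ S (P i) → Q x → Q y →
                  (∀ k → i ≡ suc k → Q (v k)) →
                  Σ (Fin n) λ u → u ∈ S (P i) × Q u × AvoidsRight i u × (∀ k → i ≡ suc k → u ≡ v k)
  choose-forcer i Q x≢y x∈S y∈S qx qy q-left with leftJunction? i | rightJunction? i
  ... | inj₁ (k , refl) | _ =
    v k , meetIn₂ k , q-left k refl ,
    (λ k′ i≡k′ vk≡vk′ → inject₁≢suc k′ (trans (sym i≡k′) (cong suc (distinct k k′ vk≡vk′)))) ,
    (λ { k′ refl → refl })
  ... | inj₂ no-left | inj₁ (k , refl) =
    let (u , (u∈S , qu) , u≢vk) = avoiding (λ z → z ∈ S (P i) × Q z) (v k) x≢y (x∈S , qx) (y∈S , qy)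
    in u , u∈S , qu , (λ k′ e → subst (λ k″ → u ≢ v k″) (inject₁-injective e) u≢vk) ,
       (λ k′ e → ⊥-elim (no-left k′ e))
  ... | inj₂ no-left | inj₂ no-right =
    _ , x∈S , qx , (λ k e → ⊥-elim (no-right k e)) , (λ k e → ⊥-elim (no-left k e))

  choose-target : ∀ i (Q : Fin n → Set) {x y} → x ≢ y → x ∈ S (P i) → y ∈ S (P i) → Q x → Q y →
                  (∀ k → i ≡ inject₁ k → Q (v k)) → ∀ {u} → AvoidsRight i u →
                  Σ (Fin n) λ t → t ∈ S (P i) × Q t × u ≢ t
  choose-target i Q x≢y x∈S y∈S qx qy q-right {u} u-avoids with rightJunction? i
  ... | inj₁ (k , refl) = v k , meetIn₁ k , q-right k refl , u-avoids k refl
  ... | inj₂ _          =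
    let (t , (t∈S , qt) , t≢u) = avoiding (λ z → z ∈ S (P i) × Q z) u x≢y (x∈S , qx) (y∈S , qy)
    in t , t∈S , qt , ≢-sym t≢u

  avoidsLeft-≢ : ∀ i {u t} → (∀ k → i ≡ suc k → u ≡ v k) → u ≢ t → AvoidsLeft i t
  avoidsLeft-≢ i u-left u≢t k e t≡vk = u≢t (trans (u-left k e) (sym t≡vk))

  -- How piece i is filled once the earlier pieces are; its targets are the vertices left out of B.
  -- Forcers avoid the junction with the next piece, so all their neighbours lie in this or earlier
  -- pieces; targets avoid the junction with the previous piece, so no vertex is the target of two plans.
  data Plan (i : Fin (suc m)) : Set where
    edgeless : (∀ x y → ¬ PieceAdj (P i) x y) → Plan i
    single   : ∀ u t → PieceAdj (P i) u t → AvoidsRight i u → AvoidsLeft i t → ¬ ProperStar (P i) → Plan i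
    double   : ∀ l c t → kind (P i) ≡ star c → l ∈ S (P i) → t ∈ S (P i) → l ≢ c → t ≢ c → l ≢ t →
               AvoidsRight i l → AvoidsLeft i c → AvoidsRight i c → AvoidsLeft i t → Plan i

  Target : ∀ {i} → Plan i → Fin n → Set
  Target (edgeless _)                        x = Empty
  Target (single _ t _ _ _ _)                x = x ≡ t
  Target (double _ c t _ _ _ _ _ _ _ _ _ _)  x = x ≡ c ⊎ x ≡ t

  target? : ∀ {i} (pl : Plan i) x → Dec (Target pl x)
  target? (edgeless _)                        x = no (λ ())
  target? (single _ t _ _ _ _)                x = x ≟ t
  target? (double _ c t _ _ _ _ _ _ _ _ _ _)  x = (x ≟ c) ⊎-dec (x ≟ t)

  target∈S : ∀ {i} (pl : Plan i) {x} → Target pl x → x ∈ S (P i)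
  target∈S (single _ _ ut _ _ _)                 refl        = proj₂ (adj⇒∈S (P _) ut)
  target∈S (double _ c _ k _ _ _ _ _ _ _ _ _)    (inj₁ refl) = centreIn (P _) c k
  target∈S (double _ _ _ _ _ t∈S _ _ _ _ _ _ _)  (inj₂ refl) = t∈S

  target-avoidsLeft : ∀ {i} (pl : Plan i) {x} → Target pl x → AvoidsLeft i x
  target-avoidsLeft (single _ _ _ _ t-avoids _)                refl        = t-avoids
  target-avoidsLeft (double _ _ _ _ _ _ _ _ _ _ c-avoids _ _)  (inj₁ refl) = c-avoids
  target-avoidsLeft (double _ _ _ _ _ _ _ _ _ _ _ _ t-avoids)  (inj₂ refl) = t-avoids

  plan : ∀ i → Plan i
  plan i with any? (λ x → any? (λ y → adj? (P i) x y)) | properStar? (P i)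
  ... | no no-edge | _ = edgeless (λ x y xy → no-edge (x , y , xy))
  ... | yes _ | yes (c , k , tl@(l₁ , l₂ , l₁∈S , l₂∈S , l₁≢c , l₂≢c , l₁≢l₂)) =
    let (c-avoidsL , c-avoidsR) = properStar-centre-avoids i k tl
        (l , l∈S , l≢c , l-avoids , l-left) =
          choose-forcer i (_≢ c) l₁≢l₂ l₁∈S l₂∈S l₁≢c l₂≢c (λ j e vj≡c → c-avoidsL j e (sym vj≡c))
        (t , t∈S , t≢c , l≢t) =
          choose-target i (_≢ c) l₁≢l₂ l₁∈S l₂∈S l₁≢c l₂≢c (λ j e vj≡c → c-avoidsR j e (sym vj≡c)) l-avoids
    in double l c t k l∈S t∈S l≢c t≢c l≢t l-avoids c-avoidsL c-avoidsR (avoidsLeft-≢ i l-left l≢t)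
  ... | yes (x , y , xy) | no ¬ps =
    let (x∈S , y∈S) = adj⇒∈S (P i) xy
        (u , u∈S , _ , u-avoids , u-left) = choose-forcer i (λ _ → ⊤) (adj⇒≢ (P i) xy) x∈S y∈S tt tt _
        (t , t∈S , _ , u≢t) = choose-target i (λ _ → ⊤) (adj⇒≢ (P i) xy) x∈S y∈S tt tt _ u-avoids
    in single u t (¬properStar⇒adj (P i) ¬ps u∈S t∈S u≢t) u-avoids (avoidsLeft-≢ i u-left u≢t) ¬ps

  IsTarget : Fin n → Set
  IsTarget x = ∃ λ i → Target (plan i) x

  isTarget? : ∀ x → Dec (IsTarget x)
  isTarget? x = any? (λ i → target? (plan i) x)

  B : Subset n
  B = toSubset (λ x → ∈union? P x ×-dec ¬? (isTarget? x))

  ∈B⁻ : ∀ {x} → x ∈ B → V G x × ¬ IsTarget x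
  ∈B⁻ = ∈-toSubset⁻ _

  ∈B⁺ : ∀ {x} → V G x → ¬ IsTarget x → x ∈ B
  ∈B⁺ vx ¬target = ∈-toSubset⁺ (λ x → ∈union? P x ×-dec ¬? (isTarget? x)) (vx , ¬target)

  target-unique : ∀ x i j → Target (plan i) x → Target (plan j) x → i ≡ j
  target-unique x i j x-i x-j with <-cmpᶠ i j
  ... | tri≈ _ i≡j _ = i≡j
  ... | tri< i<j _ _ =
    let (k , _ , j≡suck , x≡vk) = shared-vertex j i (target∈S _ x-j) (target∈S _ x-i) i<j
    in ⊥-elim (target-avoidsLeft (plan j) x-j k j≡suck x≡vk)
  ... | tri> _ _ j<i =
    let (k , _ , i≡suck , x≡vk) = shared-vertex i j (target∈S _ x-i) (target∈S _ x-j) j<i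
    in ⊥-elim (target-avoidsLeft (plan i) x-i k i≡suck x≡vk)

  #plans-targeting : ∀ x → count (λ i → target? (plan i) x) ≡ χ (isTarget? x)
  #plans-targeting x = count-unique (λ i → target? (plan i) x) (target-unique x) (isTarget? x)

  φ≤#targets : ∀ i (pl : Plan i) → φ (P i) ∅ ≤ count (target? pl)
  φ≤#targets i (edgeless no-edge) = ≤-trans (≤-reflexive (cong₂ _+_ no-open-edge no-open-centre)) z≤n
    where
    no-open-edge : χ (openEdge? (P i) ∅) ≡ 0
    no-open-edge = χ-no (openEdge? (P i) ∅) λ { (x , y , xy , _) → no-edge x y xy }
    no-open-centre : χ (openCentre? (P i) ∅) ≡ 0
    no-open-centre = χ-no (openCentre? (P i) ∅) λ { (c , k , _ , (l , _ , l∈S , _ , l≢c , _)) →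
      no-edge c l (Equivalence.from (starAdj (P i) k) (centreIn (P i) c k , l∈S , ≢-sym l≢c , inj₁ refl)) }
  φ≤#targets i (single _ t _ _ _ ¬ps) = begin
    φ (P i) ∅    ≤⟨ +-mono-≤ (χ≤1 (openEdge? (P i) ∅)) (≤-reflexive no-open-centre) ⟩
    1 + 0        ≡⟨ count-≡ t ⟨
    count (_≟ t) ∎
    where
    open ≤-Reasoning
    no-open-centre : χ (openCentre? (P i) ∅) ≡ 0
    no-open-centre = χ-no (openCentre? (P i) ∅) λ { (c , k , _ , tl) → ¬ps (c , k , tl) }
  φ≤#targets i (double _ c t _ _ _ _ t≢c _ _ _ _ _) = begin
    φ (P i) ∅                            ≤⟨ +-mono-≤ (χ≤1 (openEdge? (P i) ∅)) (χ≤1 (openCentre? (P i) ∅)) ⟩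
    1 + 1                                ≡⟨ cong₂ _+_ (count-≡ c) (count-≡ t) ⟨
    count (_≟ c) + count (_≟ t)          ≡⟨ ∑-distrib-+ (λ x → χ (x ≟ c)) (λ x → χ (x ≟ t)) ⟨
    ∑ (λ x → χ (x ≟ c) + χ (x ≟ t))      ≡⟨ ∑-cong (λ x → χ-⊎ _ (x ≟ c) (x ≟ t) id id c≢t) ⟨
    count (λ x → (x ≟ c) ⊎-dec (x ≟ t))  ∎
    where
    open ≤-Reasoning
    c≢t : ∀ {x} → x ≡ c → x ≡ t → Empty
    c≢t refl t≡x = t≢c (sym t≡x)

  ∣B∣+Φ≤order : ∣ B ∣ + Φ P ∅ ≤ count (∈union? P)
  ∣B∣+Φ≤order = begin
    ∣ B ∣ + Φ P ∅
      ≤⟨ +-mono-≤ (≤-reflexive (∣p∣≡count B)) (∑-mono-≤ (λ i → φ≤#targets i (plan i))) ⟩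
    count (_∈? B) + ∑ (λ i → count (target? (plan i)))
      ≡⟨ cong (count (_∈? B) +_) (∑-comm (λ i x → χ (target? (plan i) x))) ⟩
    count (_∈? B) + ∑ (λ x → count (λ i → target? (plan i) x))
      ≡⟨ cong (count (_∈? B) +_) (∑-cong #plans-targeting) ⟩
    count (_∈? B) + count isTarget?
      ≡⟨ ∑-distrib-+ (λ x → χ (x ∈? B)) (λ x → χ (isTarget? x)) ⟨
    ∑ (λ x → χ (x ∈? B) + χ (isTarget? x))
      ≡⟨ ∑-cong (λ x → χ-⊎ (∈union? P x) (x ∈? B) (isTarget? x) in-B-or-target in-union (proj₂ ∘ ∈B⁻)) ⟨
    count (∈union? P)
      ∎
    where
    open ≤-Reasoning
    in-union : ∀ {x} → x ∈ B ⊎ IsTarget x → V G x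
    in-union (inj₁ x∈B)         = proj₁ (∈B⁻ x∈B)
    in-union (inj₂ (i , x-i))  = i , target∈S (plan i) x-i
    in-B-or-target : ∀ {x} → V G x → x ∈ B ⊎ IsTarget x
    in-B-or-target {x} vx with isTarget? x
    ... | yes target  = inj₂ target
    ... | no ¬target = inj₁ (∈B⁺ vx ¬target)

  FilledBefore : ℕ → Subset n → Set
  FilledBefore t F = ∀ j {x} → toℕ j < t → x ∈ S (P j) → x ∈ F

  Ready : Fin (suc m) → Subset n → Set
  Ready i F = B ⊆ F × FilledBefore (toℕ i) F

  ready-mono : ∀ i {F F′} → F ⊆ F′ → Ready i F → Ready i F′
  ready-mono i F⊆F′ (B⊆F , filled) = (λ x∈B → F⊆F′ (B⊆F x∈B)) , (λ j j<i x∈j → F⊆F′ (filled j j<i x∈j))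

  Covered : ∀ i → Plan i → Set
  Covered i pl = ∀ {F} → Ready i F → ∀ {x} → x ∈ S (P i) → Target pl x ⊎ x ∈ F

  plan-covered : ∀ i → Covered i (plan i)
  plan-covered i (B⊆F , filled) {x} x∈S with isTarget? x
  ... | no ¬target = inj₂ (B⊆F (∈B⁺ (i , x∈S) ¬target))
  ... | yes (j , x-j) with <-cmpᶠ j i
  ...   | tri≈ _ refl _ = inj₁ x-j
  ...   | tri< j<i _ _  = inj₂ (filled j j<i (target∈S _ x-j))
  ...   | tri> _ _ i<j  =
    let (k , _ , j≡suck , x≡vk) = shared-vertex j i (target∈S _ x-j) x∈S i<j
    in ⊥-elim (target-avoidsLeft (plan j) x-j k j≡suck x≡vk)

  filled-unless-target : ∀ {i} (pl : Plan i) → Covered i pl → ∀ {F} → Ready i F →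
                         ∀ {x} → x ∈ S (P i) → ¬ Target pl x → x ∈ F
  filled-unless-target pl covered ready x∈S ¬target =
    [ (λ target → ⊥-elim (¬target target)) , id ]′ (covered ready x∈S)

  ready-next : ∀ i (pl : Plan i) → Covered i pl → ∀ {F} → Ready i F → (∀ {x} → Target pl x → x ∈ F) →
               FilledBefore (suc (toℕ i)) F
  ready-next i pl covered ready targets-filled j j<1+i x∈S with m<1+n⇒m<n∨m≡n j<1+i
  ... | inj₁ j<i = proj₂ ready j j<i x∈S
  ... | inj₂ j≡i with toℕ-injective j≡i
  ...   | refl = [ targets-filled , id ]′ (covered ready x∈S)

  -- As u avoids the junction with the next piece, its neighbours outside P i lie in earlier pieces.
  forces-in-piece : ∀ i {F u w} → Ready i F → u ∈ S (P i) → AvoidsRight i u → u ∈ F → w ∉ F →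
                    PieceAdj (P i) u w → (∀ x → x ∈ S (P i) → PieceAdj (P i) u x → x ≢ w → x ∈ F) →
                    Forces G F u w
  forces-in-piece i (_ , filled) u∈S u-avoids u∈F w∉F uw nb =
    (i , u∈S) , u∈F , (i , proj₂ (adj⇒∈S (P i) uw)) , w∉F , (i , uw) , neighbours-filled
    where
    neighbours-filled : ∀ x → V G x → Adj G _ x → x ≢ _ → x ∈ _
    neighbours-filled x _ (j , ux) x≢w with <-cmpᶠ j i
    ... | tri≈ _ refl _ = nb x (proj₂ (adj⇒∈S (P j) ux)) ux x≢w
    ... | tri< j<i _ _  = filled j j<i (proj₂ (adj⇒∈S (P j) ux))
    ... | tri> _ _ i<j  =
      let (k , i≡inject₁k , _ , u≡vk) = shared-vertex j i (proj₁ (adj⇒∈S (P j) ux)) u∈S i<j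
      in ⊥-elim (u-avoids k i≡inject₁k u≡vk)

  fill-vertex : ∀ i {F} w → Ready i F → (w ∉ F → Σ (Fin n) λ u → Forces G F u w) →
                (∀ {F′} → Ready i F′ → F ⊆ F′ → w ∈ F′ → FillsAll G F′) → FillsAll G F
  fill-vertex i {F} w ready force-w continue with w ∈? F
  ... | yes w∈F = continue ready id w∈F
  ... | no w∉F  = let (u , fw) = force-w w∉F
                  in force u w fw (continue (ready-mono i (p⊆p∪q _) ready) (p⊆p∪q _) (x∈p∪⁅x⁆ F w))

  fill-piece : ∀ i (pl : Plan i) → Covered i pl → ∀ {F} → Ready i F →
               (∀ {F′} → B ⊆ F′ → FilledBefore (suc (toℕ i)) F′ → FillsAll G F′) → FillsAll G F
  fill-piece i pl@(edgeless _) covered ready continue =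
    continue (proj₁ ready) (ready-next i pl covered ready (λ ()))
  fill-piece i pl@(single u t ut u-avoids _ _) covered {F} ready continue =
    fill-vertex i t ready u-forces-t λ ready′ _ t∈F′ →
    continue (proj₁ ready′) (ready-next i pl covered ready′ λ { refl → t∈F′ })
    where
    u∈S = proj₁ (adj⇒∈S (P i) ut)
    u-forces-t : t ∉ F → Σ (Fin n) λ u′ → Forces G F u′ t
    u-forces-t t∉F =
      u , forces-in-piece i ready u∈S u-avoids (filled-unless-target pl covered ready u∈S (adj⇒≢ (P i) ut))
                          t∉F ut (λ x x∈S _ x≢t → filled-unless-target pl covered ready x∈S x≢t)
  fill-piece i pl@(double l c t k l∈S t∈S l≢c t≢c l≢t l-avoids _ c-avoids _) covered {F} ready continue =
    fill-vertex i c ready l-forces-c λ ready₂ _ c∈F₂ →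
    fill-vertex i t ready₂ (c-forces-t ready₂ c∈F₂) λ ready₃ F₂⊆F₃ t∈F₃ →
    continue (proj₁ ready₃) (ready-next i pl covered ready₃ λ { (inj₁ refl) → F₂⊆F₃ c∈F₂ ; (inj₂ refl) → t∈F₃ })
    where
    c∈S = centreIn (P i) c k
    star-adj : ∀ {x y} → PieceAdj (P i) x y ⇔ (x ∈ S (P i) × y ∈ S (P i) × x ≢ y × (x ≡ c ⊎ y ≡ c))
    star-adj = starAdj (P i) k
    l-forces-c : c ∉ F → Σ (Fin n) λ u → Forces G F u c
    l-forces-c c∉F =
      l , forces-in-piece i ready l∈S l-avoids (filled-unless-target pl covered ready l∈S [ l≢c , l≢t ]′)
                          c∉F (Equivalence.from star-adj (l∈S , c∈S , l≢c , inj₂ refl))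
                          (λ x _ lx x≢c → [ (λ l≡c → ⊥-elim (l≢c l≡c)) , (λ x≡c → ⊥-elim (x≢c x≡c)) ]′
                                            (proj₂ (proj₂ (proj₂ (Equivalence.to star-adj lx)))))
    c-forces-t : ∀ {F₂} → Ready i F₂ → c ∈ F₂ → t ∉ F₂ → Σ (Fin n) λ u → Forces G F₂ u t
    c-forces-t ready₂ c∈F₂ t∉F₂ =
      c , forces-in-piece i ready₂ c∈S c-avoids c∈F₂ t∉F₂
                          (Equivalence.from star-adj (c∈S , t∈S , ≢-sym t≢c , inj₁ refl))
                          (λ x x∈S _ x≢t → [ [ (λ { refl → c∈F₂ }) , (λ x≡t → ⊥-elim (x≢t x≡t)) ]′ , id ]′
                                             (covered ready₂ x∈S))

  fills-from : ∀ d t → d + t ≡ suc m → ∀ {F} → B ⊆ F → FilledBefore t F → FillsAll G F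
  fills-from zero    t t≡1+m B⊆F filled =
    done (λ x (j , x∈j) → filled j (subst (toℕ j <_) (sym t≡1+m) (toℕ<n j)) x∈j)
  fills-from (suc d) t d+t≡1+m B⊆F filled =
    fill-piece i (plan i) (plan-covered i) (B⊆F , subst (λ s → FilledBefore s _) (sym toℕi≡t) filled)
      λ B⊆F′ filled′ → fills-from d (suc t) (trans (+-suc d t) d+t≡1+m) B⊆F′
                         (subst (λ s → FilledBefore (suc s) _) toℕi≡t filled′)
    where
    t<1+m : t < suc m
    t<1+m = subst (suc t ≤_) d+t≡1+m (s≤s (m≤n+m t d))
    i = fromℕ< t<1+m
    toℕi≡t : toℕ i ≡ t
    toℕi≡t = toℕ-fromℕ< t<1+m

  B-zeroForcing : IsZeroForcingSet G B
  B-zeroForcing = (λ x x∈B → proj₁ (∈B⁻ x∈B)) , fills-from (suc m) 0 (+-identityʳ _) id (λ j ())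

  B-isZ : IsZ G ∣ B ∣
  B-isZ = (B , B-zeroForcing , refl) ,
          (λ B′ zfs′ → +-cancelʳ-≤ (Φ P ∅) ∣ B ∣ ∣ B′ ∣
                         (≤-trans ∣B∣+Φ≤order (zeroForcingSet-lower-bound P B′ zfs′)))

  ∣B∣+Φ≡order : ∣ B ∣ + Φ P ∅ ≡ count (∈union? P)
  ∣B∣+Φ≡order = ≤-antisym ∣B∣+Φ≤order (zeroForcingSet-lower-bound P B B-zeroForcing)

  junction-pieces : ∀ {x} k → x ≡ v k → ∀ i → x ∈ S (P i) → i ≡ inject₁ k ⊎ i ≡ suc k
  junction-pieces k refl i vk∈i with <-cmpᶠ i (inject₁ k)
  ... | tri≈ _ i≡k _ = inj₁ i≡k
  ... | tri< i<k _ _ =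
    let (k′ , _ , k≡suck′ , vk≡vk′) = shared-vertex (inject₁ k) i (meetIn₁ k) vk∈i i<k
    in ⊥-elim (inject₁≢suc k (subst (λ k″ → inject₁ k ≡ suc k″) (distinct k′ k (sym vk≡vk′)) k≡suck′))
  ... | tri> _ _ k<i =
    let (k′ , k≡k′ , i≡suck′ , _) = shared-vertex i (inject₁ k) vk∈i (meetIn₁ k) k<i
    in inj₂ (subst (λ k″ → i ≡ suc k″) (sym (inject₁-injective k≡k′)) i≡suck′)

  #pieces-containing : ∀ x (junction? : Dec (∃ λ k → x ≡ v k)) →
                       ∑ (λ i → χ (x ∈? S (P i))) ≡ χ (∈union? P x) + χ junction?
  #pieces-containing x junction?@(no ¬junction) = begin
    ∑ (λ i → χ (x ∈? S (P i)))  ≡⟨ count-unique (λ i → x ∈? S (P i)) one-piece (∈union? P x) ⟩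
    χ (∈union? P x)             ≡⟨ +-identityʳ _ ⟨
    χ (∈union? P x) + 0         ∎
    where
    open ≡-Reasoning
    one-piece : ∀ i j → x ∈ S (P i) → x ∈ S (P j) → i ≡ j
    one-piece i j x∈i x∈j with <-cmpᶠ i j
    ... | tri≈ _ i≡j _ = i≡j
    ... | tri< i<j _ _ = let (k , _ , _ , x≡vk) = shared-vertex j i x∈j x∈i i<j in ⊥-elim (¬junction (k , x≡vk))
    ... | tri> _ _ j<i = let (k , _ , _ , x≡vk) = shared-vertex i j x∈i x∈j j<i in ⊥-elim (¬junction (k , x≡vk))
  #pieces-containing x junction?@(yes (k , refl)) = begin
    ∑ (λ i → χ (v k ∈? S (P i)))
      ≡⟨ ∑-cong (λ i → χ-⊎ (v k ∈? S (P i)) (i ≟ inject₁ k) (i ≟ suc k) (junction-pieces k refl i)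
                           [ (λ { refl → meetIn₁ k }) , (λ { refl → meetIn₂ k }) ]′
                           (λ i≡k i≡suck → inject₁≢suc k (trans (sym i≡k) i≡suck))) ⟩
    ∑ (λ i → χ (i ≟ inject₁ k) + χ (i ≟ suc k))
      ≡⟨ ∑-distrib-+ (λ i → χ (i ≟ inject₁ k)) (λ i → χ (i ≟ suc k)) ⟩
    count (_≟ inject₁ k) + count (_≟ suc k)
      ≡⟨ cong₂ _+_ (count-≡ (inject₁ k)) (count-≡ (suc k)) ⟩
    1 + 1
      ≡⟨ cong₂ _+_ (χ-yes (∈union? P (v k)) (suc k , meetIn₂ k)) (χ-yes junction? (k , refl)) ⟨
    χ (∈union? P (v k)) + χ junction?
      ∎
    where open ≡-Reasoning

  order+m≡∑∣S∣ : count (∈union? P) + m ≡ ∑ (λ i → count (_∈? S (P i)))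
  order+m≡∑∣S∣ = begin
    count (∈union? P) + m
      ≡⟨ cong (count (∈union? P) +_) #junctions ⟨
    count (∈union? P) + ∑ (λ k → count (_≟ v k))
      ≡⟨ cong (count (∈union? P) +_) (∑-comm (λ k x → χ (x ≟ v k))) ⟩
    count (∈union? P) + ∑ (λ x → count (λ k → x ≟ v k))
      ≡⟨ ∑-distrib-+ (λ x → χ (∈union? P x)) (λ x → count (λ k → x ≟ v k)) ⟨
    ∑ (λ x → χ (∈union? P x) + count (λ k → x ≟ v k))
      ≡⟨ ∑-cong multiplicity ⟨
    ∑ (λ x → ∑ (λ i → χ (x ∈? S (P i))))
      ≡⟨ ∑-comm (λ x i → χ (x ∈? S (P i))) ⟩
    ∑ (λ i → count (_∈? S (P i)))
      ∎
    where
    open ≡-Reasoning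
    #junctions : ∑ (λ k → count (_≟ v k)) ≡ m
    #junctions = trans (∑-cong (λ k → count-≡ (v k))) (∑-one m)
    multiplicity : ∀ x → ∑ (λ i → χ (x ∈? S (P i))) ≡ χ (∈union? P x) + count (λ k → x ≟ v k)
    multiplicity x = trans (#pieces-containing x junction?) (cong (χ (∈union? P x) +_) (sym #junctions-at-x))
      where
      junction? = any? (λ k → x ≟ v k)
      junction-unique : ∀ k k′ → x ≡ v k → x ≡ v k′ → k ≡ k′
      junction-unique k k′ x≡vk x≡vk′ = distinct k k′ (trans (sym x≡vk) x≡vk′)
      #junctions-at-x : count (λ k → x ≟ v k) ≡ χ junction?
      #junctions-at-x = count-unique (λ k → x ≟ v k) junction-unique junction?

pieceGraph≅unionGraph : ∀ {n} (Q : Piece n) → pieceGraph Q ≅ unionGraph {m = 0} (λ _ → Q)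
pieceGraph≅unionGraph Q = record
  { V⇒ = λ x∈S → zero , x∈S ; V⇐ = proj₂ ; Adj⇒ = λ xy → zero , xy ; Adj⇐ = proj₂ }

single-piece-path : ∀ {n} (Q : Piece n) → IsStarCliquePath {m = 0} (λ _ → Q) (λ ())
single-piece-path Q = record
  { meet = λ () ; meetIn₁ = λ () ; meetIn₂ = λ ()
  ; disjoint = λ { zero zero () }
  ; distinct = λ () ; starLeft = λ () ; starRight = λ () }

Z+φ≡∣S∣ : ∀ {n} (Q : Piece n) {z} → IsZ (pieceGraph Q) z → z + φ Q ∅ ≡ count (_∈? S Q)
Z+φ≡∣S∣ Q {z} isZ-z = begin
  z + φ Q ∅                        ≡⟨ cong₂ _+_ (isZ-unique (isZ-≅ (pieceGraph≅unionGraph Q) isZ-z) B-isZ)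
                                                (sym (+-identityʳ (φ Q ∅))) ⟩
  ∣ B ∣ + Φ {m = 0} (λ _ → Q) ∅    ≡⟨ ∣B∣+Φ≡order ⟩
  count (∈union? {m = 0} (λ _ → Q)) ≡⟨ +-identityʳ _ ⟨
  count (∈union? (λ _ → Q)) + 0    ≡⟨ order+m≡∑∣S∣ ⟩
  count (_∈? S Q) + 0              ≡⟨ +-identityʳ _ ⟩
  count (_∈? S Q)                  ∎
  where
  open ≡-Reasoning
  open StarCliquePath (λ _ → Q) (λ ()) (single-piece-path Q)

proposition5p5 : ∀ {n m} (P : Fin (suc m) → Piece n) (v : Fin m → Fin n) →
    IsStarCliquePath P v →
    (z : Fin (suc m) → ℕ) → (∀ i → IsZ (pieceGraph (P i)) (z i)) →
    IsZ (unionGraph P) (∑ z + 1 ∸ suc m)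
proposition5p5 {m = m} P v scp z isZ-z = subst (IsZ (unionGraph P)) ∣B∣≡∑z+1∸k B-isZ
  where
  open StarCliquePath P v scp
  open ≡-Reasoning
  ∣B∣+m≡∑z : ∣ B ∣ + m ≡ ∑ z
  ∣B∣+m≡∑z = +-cancelʳ-≡ (Φ P ∅) _ _ (begin
    ∣ B ∣ + m + Φ P ∅                ≡⟨ xy∙z≈xz∙y ∣ B ∣ m (Φ P ∅) ⟩
    ∣ B ∣ + Φ P ∅ + m                ≡⟨ cong (_+ m) ∣B∣+Φ≡order ⟩
    count (∈union? P) + m            ≡⟨ order+m≡∑∣S∣ ⟩
    ∑ (λ i → count (_∈? S (P i)))    ≡⟨ ∑-cong (λ i → Z+φ≡∣S∣ (P i) (isZ-z i)) ⟨
    ∑ (λ i → z i + φ (P i) ∅)        ≡⟨ ∑-distrib-+ z (λ i → φ (P i) ∅) ⟩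
    ∑ z + Φ P ∅                      ∎)
  ∣B∣≡∑z+1∸k : ∣ B ∣ ≡ ∑ z + 1 ∸ suc m
  ∣B∣≡∑z+1∸k = begin
    ∣ B ∣              ≡⟨ m+n∸n≡m ∣ B ∣ m ⟨
    ∣ B ∣ + m ∸ m      ≡⟨ cong (_∸ m) ∣B∣+m≡∑z ⟩
    ∑ z ∸ m            ≡⟨ cong (_∸ suc m) (+-comm (∑ z) 1) ⟨
    ∑ z + 1 ∸ suc m    ∎
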